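{- Suppose $A$ and $B$ are tensors over finite variable sets $X,Y,Z$ such that $A$ is a monomial degeneration of $B$, and suppose that for each $n$ the tensor power $A^{\otimes n}$ has a zeroing out into $f(n)$ independent triples. Then $B^{\otimes n}$ has a zeroing out into $\Omega(f(n)/n^2)$ independent triples.
   Context: A tensor over $X,Y,Z$ is a trilinear form $\sum T_{ijk}x_iy_jz_k$. $A$ is a monomial degeneration of $B$ if each $A_{ijk}\in\{B_{ijk},0\}$ and there are functions $a:X\to\mathbb Z$, $b:Y\to\mathbb Z$, $c:Z\to\mathbb Z$ such that whenever $B_{ijk}\ne0$, $a(x_i)+b(y_j)+c(z_k)\ge0$, with equality iff $A_{ijk}\ne0$. A zeroing out is a monomial degeneration where $a,b,c$ take only nonnegative values. $A^{\otimes n}$ is the $n$-th tensor (Kronecker) power over $X^n,Y^n,Z^n$. A tensor is independent if any two distinct terms with nonzero coefficients share no $x$-variable, no $y$-variable and no $z$-variable; a zeroing out into $m$ independent triples is a zeroing out which is independent and has $m$ nonzero terms. The implied constant in $\Omega$ depends only on $A$, $B$ and the degeneration. -}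

module Defs where

open import Level using (_⊔_)
open import Algebra.Bundles using (CommutativeRing)
open import Data.Nat using (ℕ; zero; suc)
open import Data.Integer as ℤ using (ℤ; 0ℤ)
open import Data.Fin using (Fin)
open import Data.Vec using (Vec; []; _∷_)
open import Data.Product using (Σ; ∃; _×_; _,_)
open import Data.Sum using (_⊎_)
open import Relation.Binary.PropositionalEquality using (_≡_; _≢_)
open import Relation.Nullary using (¬_)
open import Function.Definitions using (Injective)
open import Function.Bundles using (_⇔_)

module Tensors {c ℓ} (R : CommutativeRing c ℓ) where
  open CommutativeRing R renaming (Carrier to K)

  Tensor : Set → Set → Set → Set c
  Tensor X Y Z = X → Y → Z → K

  NonZero : K → Set ℓ
  NonZero v = ¬ (v ≈ 0#)

  record MonomialDegeneration {X Y Z : Set} (A B : Tensor X Y Z) : Set (c ⊔ ℓ) where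
    field
      coeff  : ∀ x y z → (A x y z ≈ B x y z) ⊎ (A x y z ≈ 0#)
      a      : X → ℤ
      b      : Y → ℤ
      c'     : Z → ℤ
      nonneg : ∀ x y z → NonZero (B x y z) → 0ℤ ℤ.≤ (a x ℤ.+ b y ℤ.+ c' z)
      tight  : ∀ x y z → NonZero (B x y z) →
               ((a x ℤ.+ b y ℤ.+ c' z ≡ 0ℤ) ⇔ NonZero (A x y z))

  open MonomialDegeneration public

  ZeroingOut : {X Y Z : Set} (A B : Tensor X Y Z) → Set (c ⊔ ℓ)
  ZeroingOut A B = Σ (MonomialDegeneration A B) λ D →
    (∀ x → 0ℤ ℤ.≤ a D x) × (∀ y → 0ℤ ℤ.≤ b D y) × (∀ z → 0ℤ ℤ.≤ c' D z)

  Independent : {X Y Z : Set} (T : Tensor X Y Z) → Set ℓ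
  Independent {X} {Y} {Z} T = ∀ (x x' : X) (y y' : Y) (z z' : Z) →
    NonZero (T x y z) → NonZero (T x' y' z') →
    (x , y , z) ≢ (x' , y' , z') → (x ≢ x') × (y ≢ y') × (z ≢ z')

  HasTerms : {X Y Z : Set} (T : Tensor X Y Z) (m : ℕ) → Set ℓ
  HasTerms {X} {Y} {Z} T m = Σ (Fin m → X × Y × Z) λ e →
    Injective _≡_ _≡_ e ×
    (∀ x y z → NonZero (T x y z) ⇔ ∃ λ l → e l ≡ (x , y , z))

  ZeroingOutInto : {X Y Z : Set} (B : Tensor X Y Z) (m : ℕ) → Set (c ⊔ ℓ)
  ZeroingOutInto {X} {Y} {Z} B m = Σ (Tensor X Y Z) λ A →
    ZeroingOut A B × Independent A × HasTerms A m

  power : {X Y Z : Set} → Tensor X Y Z → (n : ℕ) →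
          Tensor (Vec X n) (Vec Y n) (Vec Z n)
  power T zero [] [] [] = 1#
  power T (suc n) (x ∷ xs) (y ∷ ys) (z ∷ zs) = T x y z * power T n xs ys zs

module Submission where

-- Let a, b, c be the weights of the degeneration.  Summing them letterwise lifts it to
-- a monomial degeneration of B^{⊗n} into A^{⊗n} (power-degeneration).  Fix a zeroing
-- out A₀ of A^{⊗n} into independent triples (x_l, y_l, z_l).  The x-weights a(x_l) take
-- at most 2nM_a + 1 values and the y-weights at most 2nM_b + 1, so by the pigeonhole
-- principle a subfamily S holding a 1/((2nM_a+1)(2nM_b+1)) fraction of the triples has
-- constant x-weight and constant y-weight (pigeonhole₂).  Restricting B^{⊗n} to the
-- variables of S is a zeroing out whose terms are exactly the triples of S
-- (SubfamilyRestriction): a term (x_l₁, y_l₂, z_l₃) of B^{⊗n} has weight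
-- a(x_l₃) + b(y_l₃) + c(z_l₃) = 0, so it is a term of A^{⊗n} and then of A₀, where it
-- shares the variable x_l₁ with the triple l₁ and hence equals it by independence.

open import Defs
open import Algebra.Bundles using (CommutativeRing)
open import Data.Nat using (ℕ; zero; suc; _≤_; _<_; _+_; _*_; _∸_; _^_; z≤n; s≤s; _≟_; _≤?_; _⊔_)
open import Data.Nat.Properties as ℕ using (module ≤-Reasoning)
import Data.Nat.Tactic.RingSolver as ℕ-Solver
open import Data.Integer as ℤ using (ℤ; 0ℤ; 1ℤ; +_; -[1+_]; +≤+)
import Data.Integer.Properties as ℤ
open import Data.Integer.Tactic.RingSolver as ℤ-Solver using ()
open import Algebra.Properties.AbelianGroup ℤ.+-0-abelianGroup using (∙-cancelʳ)
open import Data.Fin using (Fin)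
import Data.Fin as Fin
open import Data.Vec using (Vec; []; _∷_)
import Data.Vec.Properties as Vec
open import Data.List using (List; []; _∷_; length; lookup; filter; allFin)
import Data.List.Properties as List
open import Data.List.Relation.Unary.All as All using (All)
open import Data.List.Relation.Unary.AllPairs using (_∷_)
open import Data.List.Relation.Unary.Any as Any using (Any; any?)
open import Data.List.Relation.Unary.Any.Properties using (lookup-index)
open import Data.List.Relation.Unary.Unique.Propositional using (Unique)
open import Data.List.Relation.Unary.Unique.Propositional.Properties using (allFin⁺)
import Data.List.Relation.Unary.Unique.Propositional.Properties as Unique
open import Data.List.Membership.Propositional using (_∈_; find)
open import Data.List.Membership.Propositional.Properties using (∈-filter⁻; ∈-lookup)
import Data.List.Relation.Binary.Sublist.Propositional.Properties as Sublist
open import Data.Product using (Σ; ∃; _×_; _,_; proj₁; proj₂)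
import Data.Product.Properties as Product
open import Data.Sum using (_⊎_; inj₁; inj₂)
open import Data.Empty using (⊥-elim)
open import Relation.Nullary using (Dec; yes; no; ¬?; _×-dec_)
open import Relation.Binary.Definitions using (DecidableEquality)
open import Relation.Binary.PropositionalEquality
  using (_≡_; refl; sym; trans; cong; cong₂; subst; module ≡-Reasoning)
open import Function.Bundles using (_⇔_; mk⇔; Equivalence)
open import Function.Definitions using (Injective)

fibre : ∀ {A : Set} → (A → ℕ) → ℕ → List A → List A
fibre g k = filter (λ x → g x ≟ k)

∈-fibre⁻ : ∀ {A : Set} (g : A → ℕ) k xs {x} → x ∈ fibre g k xs → x ∈ xs × g x ≡ k
∈-fibre⁻ g k xs = ∈-filter⁻ (λ x → g x ≟ k) {xs = xs}

length-filter-split : ∀ {A : Set} {P : A → Set} (P? : ∀ x → Dec (P x)) (xs : List A) →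
                      length xs ≡ length (filter P? xs) + length (filter (λ x → ¬? (P? x)) xs)
length-filter-split P? [] = refl
length-filter-split P? (x ∷ xs) with P? x
... | yes _ = cong suc (length-filter-split P? xs)
... | no _  = trans (cong suc (length-filter-split P? xs)) (sym (ℕ.+-suc _ _))

length-fibre-filter : ∀ {A : Set} {P : A → Set} (P? : ∀ x → Dec (P x)) (g : A → ℕ) k xs →
                      length (fibre g k (filter P? xs)) ≤ length (fibre g k xs)
length-fibre-filter P? g k xs =
  Sublist.length-mono-≤ (Sublist.filter⁺ _ _ (λ { refl p → p }) (Sublist.filter-⊆ P? xs))

-- Induction on K: either the fibre over K-1 is large, or the
-- remaining elements, mapped into {0, …, K-2}, have a large fibre.
pigeonhole : ∀ {A : Set} (g : A → ℕ) K (xs : List A) → All (λ x → g x < K) xs →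
             ∃ λ k → length xs ≤ K * length (fibre g k xs)
pigeonhole g zero [] _ = 0 , z≤n
pigeonhole g zero (x ∷ xs) (() All.∷ _)
pigeonhole g (suc K) xs bounded = larger (pigeonhole g K rest rest-bounded)
  where
  open ≤-Reasoning
  top : List _
  top = fibre g K xs
  rest : List _
  rest = filter (λ x → ¬? (g x ≟ K)) xs

  rest-bounded : All (λ x → g x < K) rest
  rest-bounded = All.tabulate λ x∈rest →
    let x∈xs , gx≢K = ∈-filter⁻ _ x∈rest
    in ℕ.≤∧≢⇒< (ℕ.≤-pred (All.lookup bounded x∈xs)) gx≢K

  larger : (∃ λ k → length rest ≤ K * length (fibre g k rest)) →
           ∃ λ k → length xs ≤ suc K * length (fibre g k xs)
  larger (k , rest≤) with length top ≤? length (fibre g k xs)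
  ... | yes top≤ = k , (begin
    length xs                       ≡⟨ length-filter-split _ xs ⟩
    length top + length rest        ≤⟨ ℕ.+-monoʳ-≤ _ rest≤ ⟩
    length top + K * length (fibre g k rest)
      ≤⟨ ℕ.+-mono-≤ top≤ (ℕ.*-monoʳ-≤ K (length-fibre-filter _ g k xs)) ⟩
    suc K * length (fibre g k xs)   ∎)
  ... | no top≰ = K , (begin
    length xs                       ≡⟨ length-filter-split _ xs ⟩
    length top + length rest        ≤⟨ ℕ.+-monoʳ-≤ _ rest≤ ⟩
    length top + K * length (fibre g k rest)
      ≤⟨ ℕ.+-monoʳ-≤ _ (ℕ.*-monoʳ-≤ K (ℕ.≤-trans (length-fibre-filter _ g k xs) (ℕ.≰⇒≥ top≰))) ⟩
    suc K * length top              ∎)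

lookup-injective : ∀ {A : Set} {xs : List A} → Unique xs →
                   ∀ i j → lookup xs i ≡ lookup xs j → i ≡ j
lookup-injective (_ ∷ _)     Fin.zero    Fin.zero    _  = refl
lookup-injective (x∉xs ∷ _)  Fin.zero    (Fin.suc j) eq = ⊥-elim (All.lookup x∉xs (∈-lookup j) eq)
lookup-injective (x∉xs ∷ _)  (Fin.suc i) Fin.zero    eq = ⊥-elim (All.lookup x∉xs (∈-lookup i) (sym eq))
lookup-injective (_ ∷ uniq)  (Fin.suc i) (Fin.suc j) eq = cong Fin.suc (lookup-injective uniq i j eq)

pigeonhole₂ : ∀ {T K L} (g h : Fin T → ℕ) → (∀ l → g l < K) → (∀ l → h l < L) →
              Σ (List (Fin T)) λ S → Unique S ×
                (∀ {l l'} → l ∈ S → l' ∈ S → g l ≡ g l' × h l ≡ h l') ×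
                T ≤ K * L * length S
pigeonhole₂ {T} {K} {L} g h g< h<
  with pigeonhole g K (allFin T) (All.tabulate λ {l} _ → g< l)
... | α , T≤ with pigeonhole h L (fibre g α (allFin T)) (All.tabulate λ {l} _ → h< l)
... | β , Sα≤ = S , Unique.filter⁺ _ (Unique.filter⁺ _ (allFin⁺ T)) , constant , size
  where
  S : List (Fin T)
  S = fibre h β (fibre g α (allFin T))

  values : ∀ {l} → l ∈ S → g l ≡ α × h l ≡ β
  values l∈S = let l∈Sα , hl≡β = ∈-fibre⁻ h β (fibre g α (allFin T)) l∈S
               in proj₂ (∈-fibre⁻ g α (allFin T) l∈Sα) , hl≡β

  constant : ∀ {l l'} → l ∈ S → l' ∈ S → g l ≡ g l' × h l ≡ h l'
  constant l∈S l'∈S = let gl , hl = values l∈S ; gl' , hl' = values l'∈S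
                      in trans gl (sym gl') , trans hl (sym hl')

  size : T ≤ K * L * length S
  size = begin
    T                                         ≡⟨ sym (List.length-tabulate (λ l → l)) ⟩
    length (allFin T)                         ≤⟨ T≤ ⟩
    K * length (fibre g α (allFin T))         ≤⟨ ℕ.*-monoʳ-≤ K Sα≤ ⟩
    K * (L * length S)                        ≡⟨ sym (ℕ.*-assoc K L _) ⟩
    K * L * length S                          ∎
    where open ≤-Reasoning

nonneg-sum-zero : ∀ {u v : ℤ} → 0ℤ ℤ.≤ u → 0ℤ ℤ.≤ v → u ℤ.+ v ≡ 0ℤ → u ≡ 0ℤ × v ≡ 0ℤ
nonneg-sum-zero {+ zero}  {+ zero}  (+≤+ _) (+≤+ _) _  = refl , refl
nonneg-sum-zero {+ zero}  {+ suc _} (+≤+ _) (+≤+ _) ()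
nonneg-sum-zero {+ suc _} {+ _}     (+≤+ _) (+≤+ _) ()

nonneg-sum₃-zero : ∀ {u v w : ℤ} → 0ℤ ℤ.≤ u → 0ℤ ℤ.≤ v → 0ℤ ℤ.≤ w →
                   u ℤ.+ v ℤ.+ w ≡ 0ℤ → u ≡ 0ℤ × v ≡ 0ℤ × w ≡ 0ℤ
nonneg-sum₃-zero 0≤u 0≤v 0≤w sum≡0 =
  let uv≡0 , w≡0 = nonneg-sum-zero (ℤ.+-mono-≤ 0≤u 0≤v) 0≤w sum≡0
      u≡0 , v≡0 = nonneg-sum-zero 0≤u 0≤v uv≡0
  in u≡0 , v≡0 , w≡0

sum₃-zero : ∀ {u v w : ℤ} → u ≡ 0ℤ → v ≡ 0ℤ → w ≡ 0ℤ → u ℤ.+ v ℤ.+ w ≡ 0ℤ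
sum₃-zero refl refl refl = refl

indicator : ∀ {P : Set} → Dec P → ℤ
indicator (yes _) = 0ℤ
indicator (no _)  = 1ℤ

indicator-nonneg : ∀ {P : Set} (d : Dec P) → 0ℤ ℤ.≤ indicator d
indicator-nonneg (yes _) = +≤+ z≤n
indicator-nonneg (no _)  = +≤+ z≤n

indicators-zero : ∀ {P Q R : Set} (p : Dec P) (q : Dec Q) (r : Dec R) →
                  (indicator p ℤ.+ indicator q ℤ.+ indicator r ≡ 0ℤ) ⇔ (P × Q × R)
indicators-zero {P} {Q} {R} p q r = mk⇔ holds vanish
  where
  holds-one : ∀ {P : Set} (d : Dec P) → indicator d ≡ 0ℤ → P
  holds-one (yes p) _ = p

  holds : indicator p ℤ.+ indicator q ℤ.+ indicator r ≡ 0ℤ → P × Q × R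
  holds sum≡0 =
    let p≡0 , q≡0 , r≡0 = nonneg-sum₃-zero (indicator-nonneg p) (indicator-nonneg q)
                                            (indicator-nonneg r) sum≡0
    in holds-one p p≡0 , holds-one q q≡0 , holds-one r r≡0

  vanish-one : ∀ {P : Set} (d : Dec P) → P → indicator d ≡ 0ℤ
  vanish-one (yes _) _  = refl
  vanish-one (no ¬p) p = ⊥-elim (¬p p)

  vanish : P × Q × R → indicator p ℤ.+ indicator q ℤ.+ indicator r ≡ 0ℤ
  vanish (p' , q' , r') = sum₃-zero (vanish-one p p') (vanish-one q q') (vanish-one r r')

wordWeight : ∀ {X : Set} {n} → (X → ℤ) → Vec X n → ℤ
wordWeight w []       = 0ℤ
wordWeight w (x ∷ xs) = w x ℤ.+ wordWeight w xs

finite-bound : ∀ {k} (w : Fin k → ℤ) → ∃ λ M → ∀ i → ℤ.∣ w i ∣ ≤ M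
finite-bound {zero}  w = 0 , λ ()
finite-bound {suc k} w with finite-bound (λ i → w (Fin.suc i))
... | M , bounded = ℤ.∣ w Fin.zero ∣ ⊔ M , λ
  { Fin.zero    → ℕ.m≤m⊔n _ M
  ; (Fin.suc i) → ℕ.≤-trans (bounded i) (ℕ.m≤n⊔m _ M) }

shift : ℕ → ℤ → ℕ
shift M (+ k)    = k + M
shift M -[1+ k ] = M ∸ suc k

shift-≡ : ∀ M z → ℤ.∣ z ∣ ≤ M → + shift M z ≡ z ℤ.+ + M
shift-≡ M (+ k)    _   = refl
shift-≡ M -[1+ k ] k<M = sym (ℤ.⊖-≥ k<M)

shift-≤ : ∀ M z → ℤ.∣ z ∣ ≤ M → shift M z ≤ M + M
shift-≤ M (+ k)    k≤M = ℕ.+-monoˡ-≤ M k≤M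
shift-≤ M -[1+ k ] _   = ℕ.≤-trans (ℕ.m∸n≤m M (suc k)) (ℕ.m≤m+n M M)

-- For letter weights bounded by M, the level of a word of length n is its weight
-- shifted by nM: a natural number below 2nM + 1 which determines the weight.
module Level {X : Set} (w : X → ℤ) (M : ℕ) (bounded : ∀ x → ℤ.∣ w x ∣ ≤ M) where

  level : ∀ {n} → Vec X n → ℕ
  level []       = 0
  level (x ∷ xs) = shift M (w x) + level xs

  level-≡ : ∀ {n} (xs : Vec X n) → + level xs ≡ wordWeight w xs ℤ.+ + (n * M)
  level-≡ []               = refl
  level-≡ {suc n} (x ∷ xs) = begin
    + shift M (w x) ℤ.+ + level xs
      ≡⟨ cong₂ ℤ._+_ (shift-≡ M (w x) (bounded x)) (level-≡ xs) ⟩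
    (w x ℤ.+ + M) ℤ.+ (wordWeight w xs ℤ.+ + (n * M))
      ≡⟨ regroup (w x) (wordWeight w xs) (+ M) (+ (n * M)) ⟩
    (w x ℤ.+ wordWeight w xs) ℤ.+ + (M + n * M) ∎
    where
    open ≡-Reasoning
    regroup : ∀ (u v U V : ℤ) → (u ℤ.+ U) ℤ.+ (v ℤ.+ V) ≡ (u ℤ.+ v) ℤ.+ (U ℤ.+ V)
    regroup = ℤ-Solver.solve-∀

  level-injective : ∀ {n} (xs ys : Vec X n) → level xs ≡ level ys →
                    wordWeight w xs ≡ wordWeight w ys
  level-injective {n} xs ys eq = ∙-cancelʳ (+ (n * M)) _ _
    (trans (sym (level-≡ xs)) (trans (cong +_ eq) (level-≡ ys)))

  level-≤ : ∀ {n} (xs : Vec X n) → level xs ≤ n * (M + M)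
  level-≤ []       = z≤n
  level-≤ (x ∷ xs) = ℕ.+-mono-≤ (shift-≤ M (w x) (bounded x)) (level-≤ xs)

module _ {c ℓ} (R : CommutativeRing c ℓ) where
  open Tensors R
  module K = CommutativeRing R
  open K using (_≈_; 0#) renaming (_*_ to _·_)

  zero-factorˡ : ∀ {u} v → u ≈ 0# → u · v ≈ 0#
  zero-factorˡ v u≈0 = K.trans (K.*-congʳ u≈0) (K.zeroˡ v)

  zero-factorʳ : ∀ u {v} → v ≈ 0# → u · v ≈ 0#
  zero-factorʳ u v≈0 = K.trans (K.*-congˡ v≈0) (K.zeroʳ u)

  nonzero-factors : ∀ {u v} → NonZero (u · v) → NonZero u × NonZero v
  nonzero-factors {u} {v} nz = (λ u≈0 → nz (zero-factorˡ v u≈0)) , (λ v≈0 → nz (zero-factorʳ u v≈0))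

  IsTerm : {X Y Z : Set} → Tensor X Y Z → X × Y × Z → Set ℓ
  IsTerm T (x , y , z) = NonZero (T x y z)

  module _ {X Y Z : Set} {A B : Tensor X Y Z} (D : MonomialDegeneration A B) where

    weight : X → Y → Z → ℤ
    weight x y z = a D x ℤ.+ b D y ℤ.+ c' D z

    support-agrees : ∀ {x y z} → NonZero (A x y z) → A x y z ≈ B x y z
    support-agrees {x} {y} {z} nz with coeff D x y z
    ... | inj₁ A≈B = A≈B
    ... | inj₂ A≈0 = ⊥-elim (nz A≈0)

    support-nonzero : ∀ {x y z} → NonZero (A x y z) → NonZero (B x y z)
    support-nonzero nz B≈0 = nz (K.trans (support-agrees nz) B≈0)

    support-weight : ∀ {x y z} → NonZero (A x y z) → weight x y z ≡ 0ℤ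
    support-weight nz = Equivalence.from (tight D _ _ _ (support-nonzero nz)) nz

    weight-support : ∀ {x y z} → NonZero (B x y z) → weight x y z ≡ 0ℤ → NonZero (A x y z)
    weight-support nz = Equivalence.to (tight D _ _ _ nz)

  zeroingOut-weights : ∀ {X Y Z : Set} {A B : Tensor X Y Z} (Zo : ZeroingOut A B) {x y z} →
                       NonZero (A x y z) →
                       a (proj₁ Zo) x ≡ 0ℤ × b (proj₁ Zo) y ≡ 0ℤ × c' (proj₁ Zo) z ≡ 0ℤ
  zeroingOut-weights (D , 0≤a , 0≤b , 0≤c) nz =
    nonneg-sum₃-zero (0≤a _) (0≤b _) (0≤c _) (support-weight D nz)

  independent-shared-x : ∀ {X Y Z : Set} → DecidableEquality (X × Y × Z) →
                         {T : Tensor X Y Z} → Independent T → ∀ {x y z y' z'} →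
                         NonZero (T x y z) → NonZero (T x y' z') → (x , y , z) ≡ (x , y' , z')
  independent-shared-x _≟ₜ_ T-indep {x} {y} {z} {y'} {z'} nz nz'
    with (x , y , z) ≟ₜ (x , y' , z')
  ... | yes same = same
  ... | no differ = ⊥-elim (proj₁ (T-indep _ _ _ _ _ _ nz nz' differ) refl)

  select : ∀ {P : Set} → Dec P → K.Carrier → K.Carrier
  select (yes _) v = v
  select (no _)  _ = 0#

  select-coeff : ∀ {P : Set} (d : Dec P) v → (select d v ≈ v) ⊎ (select d v ≈ 0#)
  select-coeff (yes _) v = inj₁ K.refl
  select-coeff (no _)  v = inj₂ K.refl

  select-nonzero : ∀ {P : Set} (d : Dec P) {v} → NonZero (select d v) → P × NonZero v
  select-nonzero (yes p) nz = p , nz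
  select-nonzero (no _)  nz = ⊥-elim (nz K.refl)

  select-nonzero⁺ : ∀ {P : Set} (d : Dec P) {v} → P → NonZero v → NonZero (select d v)
  select-nonzero⁺ (yes _) _ nz = nz
  select-nonzero⁺ (no ¬p) p _  = ⊥-elim (¬p p)

  module Restriction {X Y Z : Set} {PX : X → Set} {PY : Y → Set} {PZ : Z → Set}
    (PX? : ∀ x → Dec (PX x)) (PY? : ∀ y → Dec (PY y)) (PZ? : ∀ z → Dec (PZ z))
    (B : Tensor X Y Z) where

    inBox? : ∀ x y z → Dec (PX x × PY y × PZ z)
    inBox? x y z = PX? x ×-dec PY? y ×-dec PZ? z

    restrict : Tensor X Y Z
    restrict x y z = select (inBox? x y z) (B x y z)

    -- Restricting is a zeroing out: discarded variables get weight 1, kept ones 0.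
    restrict-zeroingOut : ZeroingOut restrict B
    restrict-zeroingOut = degeneration , (λ x → indicator-nonneg (PX? x))
                                       , (λ y → indicator-nonneg (PY? y))
                                       , (λ z → indicator-nonneg (PZ? z))
      where
      tight-box : ∀ x y z → NonZero (B x y z) →
                  (indicator (PX? x) ℤ.+ indicator (PY? y) ℤ.+ indicator (PZ? z) ≡ 0ℤ)
                    ⇔ NonZero (restrict x y z)
      tight-box x y z nz = mk⇔
        (λ w≡0 → select-nonzero⁺ (inBox? x y z)
                   (Equivalence.to (indicators-zero (PX? x) (PY? y) (PZ? z)) w≡0) nz)
        (λ nz' → Equivalence.from (indicators-zero (PX? x) (PY? y) (PZ? z))
                   (proj₁ (select-nonzero (inBox? x y z) nz')))

      degeneration : MonomialDegeneration restrict B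
      degeneration = record
        { coeff  = λ x y z → select-coeff (inBox? x y z) (B x y z)
        ; a      = λ x → indicator (PX? x)
        ; b      = λ y → indicator (PY? y)
        ; c'     = λ z → indicator (PZ? z)
        ; nonneg = λ x y z _ → ℤ.+-mono-≤ (ℤ.+-mono-≤ (indicator-nonneg (PX? x))
                                   (indicator-nonneg (PY? y))) (indicator-nonneg (PZ? z))
        ; tight  = tight-box
        }

    restrict-support : ∀ {x y z} → NonZero (restrict x y z) → (PX x × PY y × PZ z) × NonZero (B x y z)
    restrict-support {x} {y} {z} = select-nonzero (inBox? x y z)

    restrict-support⁺ : ∀ {x y z} → PX x × PY y × PZ z → NonZero (B x y z) → NonZero (restrict x y z)
    restrict-support⁺ {x} {y} {z} = select-nonzero⁺ (inBox? x y z)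

  module _ {X Y Z : Set} {A B : Tensor X Y Z} (D : MonomialDegeneration A B) where

    powerWeight : ∀ {n} → Vec X n → Vec Y n → Vec Z n → ℤ
    powerWeight xs ys zs = wordWeight (a D) xs ℤ.+ wordWeight (b D) ys ℤ.+ wordWeight (c' D) zs

    powerWeight-∷ : ∀ {n} x y z (xs : Vec X n) ys zs →
                    powerWeight (x ∷ xs) (y ∷ ys) (z ∷ zs) ≡ weight D x y z ℤ.+ powerWeight xs ys zs
    powerWeight-∷ x y z xs ys zs = regroup (a D x) (b D y) (c' D z)
      (wordWeight (a D) xs) (wordWeight (b D) ys) (wordWeight (c' D) zs)
      where
      regroup : ∀ (u v w U V W : ℤ) →
                (u ℤ.+ U) ℤ.+ (v ℤ.+ V) ℤ.+ (w ℤ.+ W) ≡ (u ℤ.+ v ℤ.+ w) ℤ.+ (U ℤ.+ V ℤ.+ W)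
      regroup = ℤ-Solver.solve-∀

    power-coeff : ∀ n xs ys zs → (power A n xs ys zs ≈ power B n xs ys zs) ⊎ (power A n xs ys zs ≈ 0#)
    power-coeff zero [] [] [] = inj₁ K.refl
    power-coeff (suc n) (x ∷ xs) (y ∷ ys) (z ∷ zs) with coeff D x y z | power-coeff n xs ys zs
    ... | inj₁ head | inj₁ tail = inj₁ (K.*-cong head tail)
    ... | inj₂ head | _         = inj₂ (zero-factorˡ _ head)
    ... | inj₁ _    | inj₂ tail = inj₂ (zero-factorʳ _ tail)

    power-nonneg : ∀ n xs ys zs → NonZero (power B n xs ys zs) → 0ℤ ℤ.≤ powerWeight xs ys zs
    power-nonneg zero [] [] [] _ = +≤+ z≤n
    power-nonneg (suc n) (x ∷ xs) (y ∷ ys) (z ∷ zs) nz =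
      let nz-head , nz-tail = nonzero-factors nz in
      subst (0ℤ ℤ.≤_) (sym (powerWeight-∷ x y z xs ys zs))
        (ℤ.+-mono-≤ (nonneg D x y z nz-head) (power-nonneg n xs ys zs nz-tail))

    power-support-weight : ∀ n xs ys zs → NonZero (power A n xs ys zs) → powerWeight xs ys zs ≡ 0ℤ
    power-support-weight zero [] [] [] _ = refl
    power-support-weight (suc n) (x ∷ xs) (y ∷ ys) (z ∷ zs) nz =
      let nz-head , nz-tail = nonzero-factors nz in
      trans (powerWeight-∷ x y z xs ys zs)
            (cong₂ ℤ._+_ (support-weight D nz-head) (power-support-weight n xs ys zs nz-tail))

    -- On a term of B^{⊗n} of weight 0 every letter has weight 0, so all factors agree.
    power-weight-agrees : ∀ n xs ys zs → NonZero (power B n xs ys zs) → powerWeight xs ys zs ≡ 0ℤ →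
                          power A n xs ys zs ≈ power B n xs ys zs
    power-weight-agrees zero [] [] [] _ _ = K.refl
    power-weight-agrees (suc n) (x ∷ xs) (y ∷ ys) (z ∷ zs) nz w≡0 =
      let nz-head , nz-tail = nonzero-factors nz
          head≡0 , tail≡0 = nonneg-sum-zero (nonneg D x y z nz-head) (power-nonneg n xs ys zs nz-tail)
                                            (trans (sym (powerWeight-∷ x y z xs ys zs)) w≡0)
      in K.*-cong (support-agrees D (weight-support D nz-head head≡0))
                  (power-weight-agrees n xs ys zs nz-tail tail≡0)

    power-degeneration : ∀ n → MonomialDegeneration (power A n) (power B n)
    power-degeneration n = record
      { coeff  = power-coeff n
      ; a      = wordWeight (a D)
      ; b      = wordWeight (b D)
      ; c'     = wordWeight (c' D)
      ; nonneg = power-nonneg n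
      ; tight  = λ xs ys zs nz → mk⇔
          (λ w≡0 A≈0 → nz (K.trans (K.sym (power-weight-agrees n xs ys zs nz w≡0)) A≈0))
          (power-support-weight n xs ys zs)
      }

  module SubfamilyRestriction
    {X Y Z : Set} (_≟X_ : DecidableEquality X) (_≟Y_ : DecidableEquality Y) (_≟Z_ : DecidableEquality Z)
    {A B : Tensor X Y Z} (D : MonomialDegeneration A B)
    {A₀ : Tensor X Y Z} (Zo : ZeroingOut A₀ A) (A₀-independent : Independent A₀)
    {T : ℕ} (e : Fin T → X × Y × Z) (e-injective : Injective _≡_ _≡_ e)
    (e-terms : ∀ x y z → NonZero (A₀ x y z) ⇔ ∃ λ l → e l ≡ (x , y , z))
    (S : List (Fin T)) (S-unique : Unique S)
    (S-homogeneous : ∀ {l l'} → l ∈ S → l' ∈ S →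
                     a D (proj₁ (e l)) ≡ a D (proj₁ (e l')) ×
                     b D (proj₁ (proj₂ (e l))) ≡ b D (proj₁ (proj₂ (e l'))))
    where

    x[_] : Fin T → X
    x[ l ] = proj₁ (e l)
    y[_] : Fin T → Y
    y[ l ] = proj₁ (proj₂ (e l))
    z[_] : Fin T → Z
    z[ l ] = proj₂ (proj₂ (e l))

    triple₀ : ∀ l → NonZero (A₀ x[ l ] y[ l ] z[ l ])
    triple₀ l = Equivalence.from (e-terms _ _ _) (l , refl)

    triple : ∀ l → NonZero (A x[ l ] y[ l ] z[ l ])
    triple l = support-nonzero (proj₁ Zo) (triple₀ l)

    InX : X → Set
    InX x = Any (λ l → x[ l ] ≡ x) S
    InY : Y → Set
    InY y = Any (λ l → y[ l ] ≡ y) S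
    InZ : Z → Set
    InZ z = Any (λ l → z[ l ] ≡ z) S

    InX? : ∀ x → Dec (InX x)
    InX? x = any? (λ l → x[ l ] ≟X x) S
    InY? : ∀ y → Dec (InY y)
    InY? y = any? (λ l → y[ l ] ≟Y y) S
    InZ? : ∀ z → Dec (InZ z)
    InZ? z = any? (λ l → z[ l ] ≟Z z) S

    open Restriction InX? InY? InZ? B

    -- A term of B mixing the triples l₁, l₂, l₃ of S is the triple l₁: its weight is
    -- that of the triple l₃, namely 0, so it is a term of A and then of A₀, where it
    -- shares its x-variable with the triple l₁.
    mixed-term : ∀ {l₁ l₂ l₃} → l₁ ∈ S → l₂ ∈ S → l₃ ∈ S →
                 NonZero (B x[ l₁ ] y[ l₂ ] z[ l₃ ]) → (x[ l₁ ] , y[ l₂ ] , z[ l₃ ]) ≡ e l₁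
    mixed-term {l₁} {l₂} {l₃} l₁∈S l₂∈S l₃∈S nz =
      independent-shared-x (Product.≡-dec _≟X_ (Product.≡-dec _≟Y_ _≟Z_)) A₀-independent
        mixed₀ (triple₀ l₁)
      where
      mixed-weight : weight D x[ l₁ ] y[ l₂ ] z[ l₃ ] ≡ 0ℤ
      mixed-weight = trans (cong₂ (λ u v → u ℤ.+ v ℤ.+ c' D z[ l₃ ])
                                  (proj₁ (S-homogeneous l₁∈S l₃∈S)) (proj₂ (S-homogeneous l₂∈S l₃∈S)))
                           (support-weight D (triple l₃))

      mixed₀ : NonZero (A₀ x[ l₁ ] y[ l₂ ] z[ l₃ ])
      mixed₀ = weight-support (proj₁ Zo) (weight-support D nz mixed-weight)
                 (sum₃-zero (proj₁ (zeroingOut-weights Zo (triple₀ l₁)))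
                            (proj₁ (proj₂ (zeroingOut-weights Zo (triple₀ l₂))))
                            (proj₂ (proj₂ (zeroingOut-weights Zo (triple₀ l₃)))))

    restrict-terms : ∀ {x y z} → NonZero (restrict x y z) → ∃ λ l → l ∈ S × e l ≡ (x , y , z)
    restrict-terms nz with restrict-support nz
    ... | (inX , inY , inZ) , nzB with find inX | find inY | find inZ
    ... | l₁ , l₁∈S , refl | _ , l₂∈S , refl | _ , l₃∈S , refl =
      l₁ , l₁∈S , sym (mixed-term l₁∈S l₂∈S l₃∈S nzB)

    restrict-terms⁺ : ∀ {l} → l ∈ S → IsTerm restrict (e l)
    restrict-terms⁺ {l} l∈S = restrict-support⁺
      (Any.map (λ l≡ → cong x[_] (sym l≡)) l∈S , Any.map (λ l≡ → cong y[_] (sym l≡)) l∈S ,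
       Any.map (λ l≡ → cong z[_] (sym l≡)) l∈S)
      (support-nonzero D (triple l))

    restrict-independent : Independent restrict
    restrict-independent x x' y y' z z' nz nz' = A₀-independent x x' y y' z z' (term₀ nz) (term₀ nz')
      where
      term₀ : ∀ {x y z} → NonZero (restrict x y z) → NonZero (A₀ x y z)
      term₀ {x} {y} {z} nz = let l , _ , eq = restrict-terms nz in Equivalence.from (e-terms x y z) (l , eq)

    restrict-hasTerms : HasTerms restrict (length S)
    restrict-hasTerms = e₁ , e₁-injective , λ x y z → mk⇔ enumerate listed
      where
      e₁ : Fin (length S) → X × Y × Z
      e₁ i = e (lookup S i)

      e₁-injective : Injective _≡_ _≡_ e₁
      e₁-injective eq = lookup-injective S-unique _ _ (e-injective eq)

      enumerate : ∀ {x y z} → NonZero (restrict x y z) → ∃ λ i → e₁ i ≡ (x , y , z)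
      enumerate nz = let l , l∈S , eq = restrict-terms nz
                     in Any.index l∈S , trans (cong e (sym (lookup-index l∈S))) eq

      listed : ∀ {x y z} → (∃ λ i → e₁ i ≡ (x , y , z)) → NonZero (restrict x y z)
      listed (i , eq) = subst (IsTerm restrict) eq (restrict-terms⁺ (∈-lookup i))

    subfamily-zeroingOut : ZeroingOutInto B (length S)
    subfamily-zeroingOut = restrict , restrict-zeroingOut , restrict-independent , restrict-hasTerms

module _ {c ℓ} (R : CommutativeRing c ℓ) where
  open Tensors R

  power-subfamily : ∀ {p q r} {A B : Tensor (Fin p) (Fin q) (Fin r)} (D : MonomialDegeneration A B)
                    {Ma Mb : ℕ} → (∀ x → ℤ.∣ a D x ∣ ≤ Ma) → (∀ y → ℤ.∣ b D y ∣ ≤ Mb) →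
                    ∀ n {T} → ZeroingOutInto (power A n) T →
                    Σ ℕ λ m → ZeroingOutInto (power B n) m ×
                              T ≤ suc (n * (Ma + Ma)) * suc (n * (Mb + Mb)) * m
  power-subfamily {p} {q} {r} D {Ma} {Mb} a-bound b-bound n {T}
                  (A₀ , Zo , A₀-independent , e , e-injective , e-terms) =
    length S , subfamily-zeroingOut , T≤
    where
    module LA = Level (a D) Ma a-bound
    module LB = Level (b D) Mb b-bound

    x-level : Fin T → ℕ
    x-level l = LA.level (proj₁ (e l))
    y-level : Fin T → ℕ
    y-level l = LB.level (proj₁ (proj₂ (e l)))

    family : Σ (List (Fin T)) λ S → Unique S ×
               (∀ {l l'} → l ∈ S → l' ∈ S → x-level l ≡ x-level l' × y-level l ≡ y-level l') ×
               T ≤ suc (n * (Ma + Ma)) * suc (n * (Mb + Mb)) * length S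
    family = pigeonhole₂ x-level y-level (λ l → s≤s (LA.level-≤ (proj₁ (e l))))
                                         (λ l → s≤s (LB.level-≤ (proj₁ (proj₂ (e l)))))

    S : List (Fin T)
    S = proj₁ family

    T≤ : T ≤ suc (n * (Ma + Ma)) * suc (n * (Mb + Mb)) * length S
    T≤ = proj₂ (proj₂ (proj₂ family))

    S-homogeneous : ∀ {l l'} → l ∈ S → l' ∈ S →
                    wordWeight (a D) (proj₁ (e l)) ≡ wordWeight (a D) (proj₁ (e l')) ×
                    wordWeight (b D) (proj₁ (proj₂ (e l))) ≡ wordWeight (b D) (proj₁ (proj₂ (e l')))
    S-homogeneous {l} {l'} l∈S l'∈S =
      let same-x , same-y = proj₁ (proj₂ (proj₂ family)) l∈S l'∈S
      in LA.level-injective (proj₁ (e l)) (proj₁ (e l')) same-x ,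
         LB.level-injective (proj₁ (proj₂ (e l))) (proj₁ (proj₂ (e l'))) same-y

    open SubfamilyRestriction R (Vec.≡-dec Fin._≟_) (Vec.≡-dec Fin._≟_) (Vec.≡-dec Fin._≟_)
      (power-degeneration R D n) Zo A₀-independent e e-injective e-terms
      S (proj₁ (proj₂ family)) S-homogeneous
      using (subfamily-zeroingOut)

pigeonhole-loss : ∀ n Ma Mb m → 1 ≤ n →
                  suc (n * (Ma + Ma)) * suc (n * (Mb + Mb)) * m ≤ suc (Ma + Ma) * suc (Mb + Mb) * (n ^ 2) * m
pigeonhole-loss n Ma Mb m 1≤n = begin
  suc (n * (Ma + Ma)) * suc (n * (Mb + Mb)) * m
    ≤⟨ ℕ.*-monoˡ-≤ m (ℕ.*-mono-≤ (grade Ma) (grade Mb)) ⟩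
  n * suc (Ma + Ma) * (n * suc (Mb + Mb)) * m
    ≡⟨ regroup n (suc (Ma + Ma)) (suc (Mb + Mb)) m ⟩
  suc (Ma + Ma) * suc (Mb + Mb) * (n ^ 2) * m ∎
  where
  open ≤-Reasoning
  grade : ∀ M → suc (n * (M + M)) ≤ n * suc (M + M)
  grade M = subst (suc (n * (M + M)) ≤_) (sym (ℕ.*-suc n (M + M))) (ℕ.+-monoˡ-≤ _ 1≤n)
  regroup : ∀ n c₁ c₂ m → n * c₁ * (n * c₂) * m ≡ c₁ * c₂ * (n * (n * 1)) * m
  regroup = ℕ-Solver.solve-∀

lemma6 : ∀ {c ℓ} (R : CommutativeRing c ℓ) {p q r : ℕ}
         (A B : Tensors.Tensor R (Fin p) (Fin q) (Fin r)) →
         Tensors.MonomialDegeneration R A B →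
         Σ ℕ λ C → Σ ℕ λ N →
         ∀ (f : ℕ → ℕ) →
         (∀ n → Tensors.ZeroingOutInto R (Tensors.power R A n) (f n)) →
         ∀ n → N ≤ n →
         Σ ℕ λ m → Tensors.ZeroingOutInto R (Tensors.power R B n) m × f n ≤ C * (n ^ 2) * m
lemma6 R A B D = C , 1 , λ f zeroingOuts n 1≤n →
  let m , zeroingOut , f≤ = power-subfamily R D Ma-bound Mb-bound n (zeroingOuts n)
  in m , zeroingOut , ℕ.≤-trans f≤ (pigeonhole-loss n Ma Mb m 1≤n)
  where
  open Tensors R using (a; b)
  Ma : ℕ
  Ma = proj₁ (finite-bound (a D))
  Ma-bound : ∀ x → ℤ.∣ a D x ∣ ≤ Ma
  Ma-bound = proj₂ (finite-bound (a D))
  Mb : ℕ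
  Mb = proj₁ (finite-bound (b D))
  Mb-bound : ∀ y → ℤ.∣ b D y ∣ ≤ Mb
  Mb-bound = proj₂ (finite-bound (b D))
  C : ℕ
  C = suc (Ma + Ma) * suc (Mb + Mb)
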